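{- A $3$-graph $H$ has a vanishing ordering if and only if there exists a simple directed graph $G$ on the same vertex set as $H$, together with a colouring of the edges of $G$ by colours $1,2,3$, such that (i) for every edge of $H$ its vertices can be labelled $u,v,w$ so that $(u,v)$, $(v,w)$, $(w,u)$ are edges of $G$ coloured $1$, $2$, $3$ respectively, and (ii) there exist distinct $i,j\in\{1,2,3\}$ such that the subgraph of $G$ consisting of all edges coloured $i$ or $j$ is acyclic.
   Context: A $3$-graph is a $3$-uniform hypergraph. An ordering $v_1,\ldots,v_n$ of the vertices of a $3$-graph $H$ is vanishing if the set of pairs $(i,j)$, $1\le i<j\le n$, can be partitioned into sets $L$, $T$, $R$ such that every edge $\{v_i,v_j,v_k\}$ of $H$ with $i<j<k$ satisfies $(i,j)\in L$, $(i,k)\in T$ and $(j,k)\in R$. A directed graph is simple if each pair of vertices is joined by at most one directed edge (no parallel edges and no pair of oppositely oriented edges). -}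

module Defs where

open import Data.Nat using (ℕ)
open import Data.Fin using (Fin; _<_)
open import Data.Maybe using (Maybe; just; nothing)
open import Data.Product using (Σ; _×_; ∃; ∃-syntax; _,_)
open import Data.Sum using (_⊎_)
open import Function.Bundles using (_↔_; Inverse)
open import Relation.Binary.PropositionalEquality using (_≡_; _≢_)
open import Relation.Nullary using (¬_)
open import Relation.Binary.Construct.Closure.Transitive using (TransClosure)

-- A 3-graph on vertex set Fin n: a set of 3-element subsets of Fin n,
-- represented by its characteristic predicate on ordered triples, which is
-- invariant under permutations and only holds on triples of distinct vertices.
record ThreeGraph (n : ℕ) : Set₁ where
  field
    Edge      : Fin n → Fin n → Fin n → Set
    swap₁₂    : ∀ {a b c} → Edge a b c → Edge b a c
    swap₂₃    : ∀ {a b c} → Edge a b c → Edge a c b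
    distinct₁₂ : ∀ {a b c} → Edge a b c → a ≢ b
    distinct₂₃ : ∀ {a b c} → Edge a b c → b ≢ c
    distinct₁₃ : ∀ {a b c} → Edge a b c → a ≢ c
open ThreeGraph public

data Part : Set where
  L T R : Part

-- An ordering v_1,…,v_n is a bijection σ from positions to vertices (v_i = σ i).
-- It is vanishing if the pairs (i,j), i<j, can be partitioned into L, T, R
-- (given by a labelling function `part`; its values at pairs with i ≥ j are
-- irrelevant) such that every edge {v_i,v_j,v_k}, i<j<k, has
-- (i,j) ∈ L, (i,k) ∈ T, (j,k) ∈ R.
IsVanishing : ∀ {n} → ThreeGraph n → (Fin n ↔ Fin n) → Set
IsVanishing {n} H σ =
  Σ (Fin n → Fin n → Part) λ part →
    ∀ (i j k : Fin n) → i < j → j < k →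
      Edge H (Inverse.to σ i) (Inverse.to σ j) (Inverse.to σ k) →
      (part i j ≡ L) × (part i k ≡ T) × (part j k ≡ R)

HasVanishingOrdering : ∀ {n} → ThreeGraph n → Set
HasVanishingOrdering {n} H = Σ (Fin n ↔ Fin n) λ σ → IsVanishing H σ

data Colour : Set where
  c₁ c₂ c₃ : Colour

-- A directed graph on Fin n with coloured edges: G u v ≡ just c means
-- (u,v) is an edge of colour c; G u v ≡ nothing means (u,v) is not an edge.
ColouredDigraph : ℕ → Set
ColouredDigraph n = Fin n → Fin n → Maybe Colour

-- Simple: no loops and no pair of oppositely oriented edges
-- (at most one edge per ordered pair is built into the representation).
Simple : ∀ {n} → ColouredDigraph n → Set
Simple {n} G =
  (∀ u → G u u ≡ nothing) ×
  (∀ u v → G u v ≢ nothing → G v u ≡ nothing)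

data Perm3 {A : Set} : A → A → A → A → A → A → Set where
  p123 : ∀ {a b c} → Perm3 a b c a b c
  p132 : ∀ {a b c} → Perm3 a c b a b c
  p213 : ∀ {a b c} → Perm3 b a c a b c
  p231 : ∀ {a b c} → Perm3 b c a a b c
  p312 : ∀ {a b c} → Perm3 c a b a b c
  p321 : ∀ {a b c} → Perm3 c b a a b c

Represents : ∀ {n} → ThreeGraph n → ColouredDigraph n → Set
Represents {n} H G =
  ∀ a b c → Edge H a b c →
    ∃[ u ] ∃[ v ] ∃[ w ] (Perm3 u v w a b c ×
      (G u v ≡ just c₁) × (G v w ≡ just c₂) × (G w u ≡ just c₃))

TwoColourEdge : ∀ {n} → ColouredDigraph n → Colour → Colour → Fin n → Fin n → Set
TwoColourEdge G i j u v = (G u v ≡ just i) ⊎ (G u v ≡ just j)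

Acyclic : ∀ {n} → (Fin n → Fin n → Set) → Set
Acyclic {n} E = ∀ (v : Fin n) → ¬ TransClosure E v v

-- Given a vanishing partition of the pairs of positions, draw v_i → v_j in colour 1 or 2
-- when (i,j) ∈ L or R, and v_j → v_i in colour 3 when (i,j) ∈ T.  An edge v_i v_j v_k of H,
-- i < j < k, then becomes the triangle v_i → v_j → v_k → v_i coloured 1, 2, 3, and the edges
-- of colours 1 and 2 increase the position, so they form an acyclic digraph.
-- Conversely, the colour rotation 1 ↦ 3, 2 ↦ 1, 3 ↦ 2 preserves condition (i) and permutes
-- the colour pairs cyclically, so we may assume that colours 1 and 2 form an acyclic
-- digraph.  Along a topological order of it every triangle u → v → w → u of colours 1, 2, 3
-- has u before v before w, so labelling the pairs of positions by the colours joining them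
-- (1 ↦ L, 2 ↦ R, anything else ↦ T) is a vanishing partition.

module Submission where

open import Defs
open import Data.Nat using (ℕ; zero; suc; s<s; z<s)
open import Data.Fin using (Fin; zero; suc; _<_; punchIn)
open import Data.Fin.Properties using (<-cmp; <-irrefl; <-trans; <-asym; any?)
open import Data.Fin.Induction using (spo-wellFounded)
open import Data.Fin.Permutation
  using (Permutation; _⟨$⟩ʳ_; _⟨$⟩ˡ_; inverseʳ; inverseˡ; insert; insert-punchIn; id)
open import Data.Maybe using (Maybe; just; nothing)
import Data.Maybe as Maybe
import Data.Maybe.Properties as Maybe
open import Data.Product using (Σ; ∃; ∃-syntax; _×_; _,_; proj₁; proj₂)
open import Data.Sum using (_⊎_; inj₁; inj₂)
import Data.Sum as Sum
open import Function using (_∘_)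
open import Function.Bundles using (_⇔_; mk⇔)
open import Function.Definitions using (Injective)
open import Induction.WellFounded using (WellFounded; Acc; acc)
open import Relation.Binary.Construct.Closure.Transitive
  using (TransClosure; [_]; _∷_; _++_; transitive⁻; wellFounded⁻)
open import Relation.Binary.Definitions using (Decidable; Tri; tri<; tri≈; tri>)
open import Relation.Binary.PropositionalEquality
  using (_≡_; _≢_; refl; cong; cong₂; sym; trans; subst₂; isEquivalence; resp₂)
open import Relation.Nullary using (¬_; yes; no; contradiction)

-- Acyclic relations on Fin n and topological orders

transClosure-map : ∀ {A B : Set} {R : A → A → Set} {S : B → B → Set} (f : A → B) →
  (∀ {x y} → R x y → S (f x) (f y)) →
  ∀ {x y} → TransClosure R x y → TransClosure S (f x) (f y)
transClosure-map f R⇒S [ r ]    = [ R⇒S r ]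
transClosure-map f R⇒S (r ∷ rs) = R⇒S r ∷ transClosure-map f R⇒S rs

acyclic-pullback : ∀ {m n} {E : Fin m → Fin m → Set} {E′ : Fin n → Fin n → Set}
  (f : Fin m → Fin n) → (∀ {u v} → E u v → E′ (f u) (f v)) → Acyclic E′ → Acyclic E
acyclic-pullback f E⇒E′ acyclic v cycle = acyclic (f v) (transClosure-map f E⇒E′ cycle)

<-acyclic : ∀ {n} → Acyclic (_<_ {n})
<-acyclic v cycle = <-irrefl refl (transitive⁻ _<_ <-trans cycle)

acyclic⇒wellFounded : ∀ {n} {E : Fin n → Fin n → Set} → Acyclic E → WellFounded E
acyclic⇒wellFounded {E = E} acyclic = wellFounded⁻ E (spo-wellFounded record
  { isEquivalence = isEquivalence
  ; irrefl        = λ { refl → acyclic _ }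
  ; trans         = _++_
  ; <-resp-≈      = resp₂ (TransClosure E)
  })

Source : ∀ {n} → (Fin n → Fin n → Set) → Fin n → Set
Source E s = ∀ u → ¬ E u s

acc⇒source : ∀ {n} {E : Fin n → Fin n → Set} → Decidable E → ∀ v → Acc E v → ∃ (Source E)
acc⇒source E? v (acc rs) with any? (λ u → E? u v)
... | yes (u , e) = acc⇒source E? u (rs e)
... | no ¬pred    = v , λ u e → ¬pred (u , e)

TopologicalOrder : ∀ {n} → (Fin n → Fin n → Set) → Permutation n n → Set
TopologicalOrder E σ = ∀ i j → E (σ ⟨$⟩ʳ i) (σ ⟨$⟩ʳ j) → i < j

topologicalSort : ∀ {n} {E : Fin n → Fin n → Set} → Decidable E → Acyclic E →
  ∃ (TopologicalOrder E)
topologicalSort {zero}      E? acyclic = id , λ ()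
topologicalSort {suc m} {E} E? acyclic = insert zero s σ , ordered
  where
  source : ∃ (Source E)
  source = acc⇒source E? zero (acyclic⇒wellFounded acyclic zero)
  s : Fin (suc m)
  s = proj₁ source
  E∖s : Fin m → Fin m → Set
  E∖s a b = E (punchIn s a) (punchIn s b)
  rest : ∃ (TopologicalOrder E∖s)
  rest = topologicalSort (λ a b → E? _ _) (acyclic-pullback (punchIn s) (λ e → e) acyclic)
  σ : Permutation m m
  σ = proj₁ rest
  ordered : TopologicalOrder E (insert zero s σ)
  ordered i       zero    e = contradiction e (proj₂ source _)
  ordered zero    (suc b) e = z<s
  ordered (suc a) (suc b) e =
    s<s (proj₂ rest a b (subst₂ E (insert-punchIn zero s σ a) (insert-punchIn zero s σ b) e))

Triangle : ∀ {n} → ColouredDigraph n → Fin n → Fin n → Fin n → Set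
Triangle G u v w = (G u v ≡ just c₁) × (G v w ≡ just c₂) × (G w u ≡ just c₃)

represents-from-sorted : ∀ {n} (H : ThreeGraph n) {G : ColouredDigraph n} (σ : Permutation n n) →
  (∀ i j k → i < j → j < k → Edge H (σ ⟨$⟩ʳ i) (σ ⟨$⟩ʳ j) (σ ⟨$⟩ʳ k) →
    Triangle G (σ ⟨$⟩ʳ i) (σ ⟨$⟩ʳ j) (σ ⟨$⟩ʳ k)) →
  Represents H G
represents-from-sorted H {G} σ sorted a b c e
  with σ ⟨$⟩ˡ a | inverseʳ σ {a} | σ ⟨$⟩ˡ b | inverseʳ σ {b} | σ ⟨$⟩ˡ c | inverseʳ σ {c}
... | i | refl | j | refl | k | refl = byPositions (<-cmp i j) (<-cmp j k) (<-cmp i k)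
  where
  byPositions : Tri (i < j) (i ≡ j) (j < i) → Tri (j < k) (j ≡ k) (k < j) → Tri (i < k) (i ≡ k) (k < i) →
    ∃[ u ] ∃[ v ] ∃[ w ] (Perm3 u v w (σ ⟨$⟩ʳ i) (σ ⟨$⟩ʳ j) (σ ⟨$⟩ʳ k) × Triangle G u v w)
  byPositions (tri< i<j _ _) (tri< j<k _ _) _              = _ , _ , _ , p123 , sorted i j k i<j j<k e
  byPositions (tri< i<j _ _) (tri> _ _ k<j) (tri< i<k _ _) = _ , _ , _ , p132 , sorted i k j i<k k<j (swap₂₃ H e)
  byPositions (tri< i<j _ _) (tri> _ _ k<j) (tri> _ _ k<i) = _ , _ , _ , p312 , sorted k i j k<i i<j (swap₁₂ H (swap₂₃ H e))
  byPositions (tri> _ _ j<i) (tri< j<k _ _) (tri< i<k _ _) = _ , _ , _ , p213 , sorted j i k j<i i<k (swap₁₂ H e)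
  byPositions (tri> _ _ j<i) (tri< j<k _ _) (tri> _ _ k<i) = _ , _ , _ , p231 , sorted j k i j<k k<i (swap₂₃ H (swap₁₂ H e))
  byPositions (tri> _ _ j<i) (tri> _ _ k<j) _              = _ , _ , _ , p321 , sorted k j i k<j j<i (swap₁₂ H (swap₂₃ H (swap₁₂ H e)))
  byPositions (tri≈ _ i≡j _) _ _ = contradiction (cong (σ ⟨$⟩ʳ_) i≡j) (distinct₁₂ H e)
  byPositions _ (tri≈ _ j≡k _) _ = contradiction (cong (σ ⟨$⟩ʳ_) j≡k) (distinct₂₃ H e)
  byPositions _ _ (tri≈ _ i≡k _) = contradiction (cong (σ ⟨$⟩ʳ_) i≡k) (distinct₁₃ H e)

-- From a representation to a vanishing ordering

partOf : Maybe Colour → Part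
partOf (just c₁) = L
partOf (just c₂) = R
partOf _         = T

twoColourEdge₁₂? : ∀ {n} (G : ColouredDigraph n) → Decidable (TwoColourEdge G c₁ c₂)
twoColourEdge₁₂? G u v with G u v
... | just c₁ = yes (inj₁ refl)
... | just c₂ = yes (inj₂ refl)
... | just c₃ = no λ { (inj₁ ()) ; (inj₂ ()) }
... | nothing = no λ { (inj₁ ()) ; (inj₂ ()) }

vanishing-from-acyclic₁₂ : ∀ {n} (H : ThreeGraph n) {G : ColouredDigraph n} →
  Simple G → Represents H G → Acyclic (TwoColourEdge G c₁ c₂) → HasVanishingOrdering H
vanishing-from-acyclic₁₂ {n} H {G} (_ , antisymmetric) represents acyclic =
  σ , (λ i j → partOf (G (σ ⟨$⟩ʳ i) (σ ⟨$⟩ʳ j))) , vanishing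
  where
  sorted : ∃ (TopologicalOrder (TwoColourEdge G c₁ c₂))
  sorted = topologicalSort (twoColourEdge₁₂? G) acyclic
  σ : Permutation n n
  σ = proj₁ sorted
  ordered : TopologicalOrder (TwoColourEdge G c₁ c₂) σ
  ordered = proj₂ sorted
  vanishing : ∀ i j k → i < j → j < k → Edge H (σ ⟨$⟩ʳ i) (σ ⟨$⟩ʳ j) (σ ⟨$⟩ʳ k) →
    (partOf (G (σ ⟨$⟩ʳ i) (σ ⟨$⟩ʳ j)) ≡ L) × (partOf (G (σ ⟨$⟩ʳ i) (σ ⟨$⟩ʳ k)) ≡ T) ×
    (partOf (G (σ ⟨$⟩ʳ j) (σ ⟨$⟩ʳ k)) ≡ R)
  vanishing i j k i<j j<k e with represents _ _ _ e
  ... | _ , _ , _ , p123 , uv , vw , wu =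
    cong partOf uv , cong partOf (antisymmetric _ _ (λ ki≡nothing → contradiction (trans (sym wu) ki≡nothing) λ ())) ,
    cong partOf vw
  ... | _ , _ , _ , p132 , uv , vw , wu = contradiction (ordered k j (inj₂ vw)) (<-asym j<k)
  ... | _ , _ , _ , p213 , uv , vw , wu = contradiction (ordered j i (inj₁ uv)) (<-asym i<j)
  ... | _ , _ , _ , p231 , uv , vw , wu = contradiction (ordered k i (inj₂ vw)) (<-asym (<-trans i<j j<k))
  ... | _ , _ , _ , p312 , uv , vw , wu = contradiction (ordered k i (inj₁ uv)) (<-asym (<-trans i<j j<k))
  ... | _ , _ , _ , p321 , uv , vw , wu = contradiction (ordered k j (inj₁ uv)) (<-asym j<k)

recolour : ∀ {n} → (Colour → Colour) → ColouredDigraph n → ColouredDigraph n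
recolour f G u v = Maybe.map f (G u v)

recolour-simple : ∀ {n} (f : Colour → Colour) {G : ColouredDigraph n} → Simple G → Simple (recolour f G)
recolour-simple f (loopless , antisymmetric) =
  (λ u → cong (Maybe.map f) (loopless u)) ,
  (λ u v fuv≢nothing → cong (Maybe.map f) (antisymmetric u v (fuv≢nothing ∘ cong (Maybe.map f))))

acyclic-twoColour-sym : ∀ {n} {G : ColouredDigraph n} {i j} →
  Acyclic (TwoColourEdge G i j) → Acyclic (TwoColourEdge G j i)
acyclic-twoColour-sym = acyclic-pullback (λ u → u) Sum.swap

acyclic-twoColour-recolour : ∀ {n} {f : Colour → Colour} → Injective _≡_ _≡_ f →
  ∀ {G : ColouredDigraph n} {i j} →
  Acyclic (TwoColourEdge G i j) → Acyclic (TwoColourEdge (recolour f G) (f i) (f j))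
acyclic-twoColour-recolour f-inj =
  acyclic-pullback (λ u → u) (Sum.map (Maybe.map-injective f-inj) (Maybe.map-injective f-inj))

rotate : Colour → Colour
rotate c₁ = c₃
rotate c₂ = c₁
rotate c₃ = c₂

rotate-injective : Injective _≡_ _≡_ rotate
rotate-injective {c₁} {c₁} _ = refl
rotate-injective {c₂} {c₂} _ = refl
rotate-injective {c₃} {c₃} _ = refl

perm3-rotate : ∀ {A : Set} {u v w a b c : A} → Perm3 u v w a b c → Perm3 v w u a b c
perm3-rotate p123 = p231
perm3-rotate p132 = p321
perm3-rotate p213 = p132
perm3-rotate p231 = p312
perm3-rotate p312 = p123
perm3-rotate p321 = p213

rotate-represents : ∀ {n} (H : ThreeGraph n) {G : ColouredDigraph n} →
  Represents H G → Represents H (recolour rotate G)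
rotate-represents H represents a b c e with represents a b c e
... | u , v , w , perm , uv , vw , wu =
  v , w , u , perm3-rotate perm , cong (Maybe.map rotate) vw , cong (Maybe.map rotate) wu ,
  cong (Maybe.map rotate) uv

vanishing-from-acyclic : ∀ {n} (H : ThreeGraph n) {G : ColouredDigraph n} {i j} →
  Simple G → Represents H G → i ≢ j → Acyclic (TwoColourEdge G i j) → HasVanishingOrdering H
vanishing-from-acyclic H {i = c₁} {j = c₁} _ _ i≢j _ = contradiction refl i≢j
vanishing-from-acyclic H {i = c₂} {j = c₂} _ _ i≢j _ = contradiction refl i≢j
vanishing-from-acyclic H {i = c₃} {j = c₃} _ _ i≢j _ = contradiction refl i≢j
vanishing-from-acyclic H {i = c₁} {j = c₂} simple represents _ acyclic =
  vanishing-from-acyclic₁₂ H simple represents acyclic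
vanishing-from-acyclic H {i = c₂} {j = c₁} simple represents _ acyclic =
  vanishing-from-acyclic₁₂ H simple represents (acyclic-twoColour-sym acyclic)
vanishing-from-acyclic H {i = c₂} {j = c₃} simple represents _ acyclic =
  vanishing-from-acyclic₁₂ H (recolour-simple rotate simple) (rotate-represents H represents)
    (acyclic-twoColour-recolour rotate-injective acyclic)
vanishing-from-acyclic H {i = c₃} {j = c₂} simple represents _ acyclic =
  vanishing-from-acyclic₁₂ H (recolour-simple rotate simple) (rotate-represents H represents)
    (acyclic-twoColour-recolour rotate-injective (acyclic-twoColour-sym acyclic))
vanishing-from-acyclic H {i = c₃} {j = c₁} simple represents _ acyclic =
  vanishing-from-acyclic₁₂ H (recolour-simple rotate (recolour-simple rotate simple))
    (rotate-represents H (rotate-represents H represents))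
    (acyclic-twoColour-recolour rotate-injective (acyclic-twoColour-recolour rotate-injective acyclic))
vanishing-from-acyclic H {i = c₁} {j = c₃} simple represents _ acyclic =
  vanishing-from-acyclic₁₂ H (recolour-simple rotate (recolour-simple rotate simple))
    (rotate-represents H (rotate-represents H represents))
    (acyclic-twoColour-recolour rotate-injective
      (acyclic-twoColour-recolour rotate-injective (acyclic-twoColour-sym acyclic)))

-- From a vanishing ordering to a representation

forwardColour : Part → Maybe Colour
forwardColour L = just c₁
forwardColour R = just c₂
forwardColour T = nothing

backwardColour : Part → Maybe Colour
backwardColour T = just c₃
backwardColour _ = nothing

forwardColour-exclusive : ∀ p → forwardColour p ≢ nothing → backwardColour p ≡ nothing
forwardColour-exclusive L _ = refl
forwardColour-exclusive R _ = refl
forwardColour-exclusive T h = contradiction refl h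

backwardColour-exclusive : ∀ p → backwardColour p ≢ nothing → forwardColour p ≡ nothing
backwardColour-exclusive T _ = refl
backwardColour-exclusive L h = contradiction refl h
backwardColour-exclusive R h = contradiction refl h

backwardColour-not₁₂ : ∀ p → ¬ ((backwardColour p ≡ just c₁) ⊎ (backwardColour p ≡ just c₂))
backwardColour-not₁₂ T (inj₁ ())
backwardColour-not₁₂ T (inj₂ ())
backwardColour-not₁₂ L (inj₁ ())
backwardColour-not₁₂ L (inj₂ ())
backwardColour-not₁₂ R (inj₁ ())
backwardColour-not₁₂ R (inj₂ ())

partDigraph : ∀ {n} → (Fin n → Fin n → Part) → ColouredDigraph n
partDigraph part i j with <-cmp i j
... | tri< _ _ _ = forwardColour (part i j)
... | tri≈ _ _ _ = nothing
... | tri> _ _ _ = backwardColour (part j i)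

module _ {n} (part : Fin n → Fin n → Part) where

  partDigraph-< : ∀ {i j} → i < j → partDigraph part i j ≡ forwardColour (part i j)
  partDigraph-< {i} {j} i<j with <-cmp i j
  ... | tri< _ _ _   = refl
  ... | tri≈ i≮j _ _ = contradiction i<j i≮j
  ... | tri> i≮j _ _ = contradiction i<j i≮j

  partDigraph-> : ∀ {i j} → j < i → partDigraph part i j ≡ backwardColour (part j i)
  partDigraph-> {i} {j} j<i with <-cmp i j
  ... | tri< _ _ j≮i = contradiction j<i j≮i
  ... | tri≈ _ _ j≮i = contradiction j<i j≮i
  ... | tri> _ _ _   = refl

  partDigraph-simple : Simple (partDigraph part)
  partDigraph-simple = loopless , antisymmetric
    where
    loopless : ∀ i → partDigraph part i i ≡ nothing
    loopless i with <-cmp i i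
    ... | tri< i<i _ _ = contradiction i<i (<-irrefl refl)
    ... | tri≈ _ _ _   = refl
    ... | tri> _ _ i<i = contradiction i<i (<-irrefl refl)
    antisymmetric : ∀ i j → partDigraph part i j ≢ nothing → partDigraph part j i ≡ nothing
    antisymmetric i j with <-cmp i j
    ... | tri< i<j _ _ = λ h → trans (partDigraph-> i<j) (forwardColour-exclusive (part i j) h)
    ... | tri≈ _ _ _   = λ h → contradiction refl h
    ... | tri> _ _ j<i = λ h → trans (partDigraph-< j<i) (backwardColour-exclusive (part j i) h)

  partDigraph-increasing : ∀ i j → TwoColourEdge (partDigraph part) c₁ c₂ i j → i < j
  partDigraph-increasing i j with <-cmp i j
  ... | tri< i<j _ _ = λ _ → i<j
  ... | tri≈ _ _ _   = λ { (inj₁ ()) ; (inj₂ ()) }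
  ... | tri> _ _ _   = λ e → contradiction e (backwardColour-not₁₂ (part j i))

  partDigraph-triangle : ∀ {i j k} → i < j → j < k →
    (part i j ≡ L) × (part i k ≡ T) × (part j k ≡ R) → Triangle (partDigraph part) i j k
  partDigraph-triangle i<j j<k (ij≡L , ik≡T , jk≡R) =
    trans (partDigraph-< i<j) (cong forwardColour ij≡L) ,
    trans (partDigraph-< j<k) (cong forwardColour jk≡R) ,
    trans (partDigraph-> (<-trans i<j j<k)) (cong backwardColour ik≡T)

relabel : ∀ {n} → (Fin n → Fin n) → ColouredDigraph n → ColouredDigraph n
relabel f G u v = G (f u) (f v)

relabel-simple : ∀ {n} (f : Fin n → Fin n) {G : ColouredDigraph n} → Simple G → Simple (relabel f G)
relabel-simple f (loopless , antisymmetric) = (λ u → loopless (f u)) , (λ u v → antisymmetric (f u) (f v))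

relabel-triangle : ∀ {n} (σ : Permutation n n) {G : ColouredDigraph n} {i j k} → Triangle G i j k →
  Triangle (relabel (σ ⟨$⟩ˡ_) G) (σ ⟨$⟩ʳ i) (σ ⟨$⟩ʳ j) (σ ⟨$⟩ʳ k)
relabel-triangle σ {G} (ij , jk , ki) = unrelabel ij , unrelabel jk , unrelabel ki
  where
  unrelabel : ∀ {i j c} → G i j ≡ c → relabel (σ ⟨$⟩ˡ_) G (σ ⟨$⟩ʳ i) (σ ⟨$⟩ʳ j) ≡ c
  unrelabel = trans (cong₂ G (inverseˡ σ) (inverseˡ σ))

representation-from-vanishing : ∀ {n} (H : ThreeGraph n) → HasVanishingOrdering H →
  Σ (ColouredDigraph n) λ G → Simple G × Represents H G × Acyclic (TwoColourEdge G c₁ c₂)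
representation-from-vanishing H (σ , part , vanishing) =
  relabel (σ ⟨$⟩ˡ_) (partDigraph part) ,
  relabel-simple (σ ⟨$⟩ˡ_) (partDigraph-simple part) ,
  represents-from-sorted H σ (λ i j k i<j j<k e →
    relabel-triangle σ {partDigraph part} (partDigraph-triangle part i<j j<k (vanishing i j k i<j j<k e))) ,
  acyclic-pullback (σ ⟨$⟩ˡ_) (partDigraph-increasing part _ _) <-acyclic

lemma5p2 : (n : ℕ) (H : ThreeGraph n) →
    HasVanishingOrdering H ⇔
      (Σ (ColouredDigraph n) λ G → (Simple G × Represents H G ×
        (Σ Colour λ i → Σ Colour λ j → ((i ≢ j) × Acyclic (TwoColourEdge G i j)))))
lemma5p2 n H = mk⇔
  (λ vanishing → let G , simple , represents , acyclic = representation-from-vanishing H vanishing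
                 in G , simple , represents , c₁ , c₂ , (λ ()) , acyclic)
  (λ (G , simple , represents , i , j , i≢j , acyclic) →
    vanishing-from-acyclic H simple represents i≢j acyclic)
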